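{- For all conditional propositions $X,Y$ and every finite (possibly empty) sequence $\Gamma$: if $\vdash\lfloor\Gamma|\neg X\rfloor$ then $\vdash\lfloor\Gamma|[X]Y\leftrightarrow Y\rfloor$. In particular $\vdash\lfloor\Gamma|[\bot]Y\leftrightarrow Y\rfloor$.
   Context: $\mathcal{C}$: smallest set containing $\bot$ and a set of atoms, closed under $X\to Y$ and $[X]Y$; $\neg X:=X\to\bot$, $X\vee Y:=\neg X\to Y$, $X\wedge Y:=\neg(\neg X\vee\neg Y)$, $\top:=\neg\bot$, $X\leftrightarrow Y:=(X\to Y)\wedge(Y\to X)$. Bayesian propositions $\lfloor X_1|\cdots|X_n\rfloor$ ($n\ge1$); $\Gamma,\Delta$ finite possibly empty sequences, $\lfloor\Gamma|X\rfloor$ appending. Proof system: axioms $\lfloor A\rfloor$ for instances over $\mathcal{C}$ of a standard Hilbert system for classical propositional logic; $\lfloor[X](Y\to Z)\to([X]Y\to[X]Z)\rfloor$; $\lfloor[X]Y\to(X\to Y)\rfloor$; $\lfloor[X]\neg Y\leftrightarrow\neg[X]Y\rfloor$. Rules: from $\lfloor\Gamma|X\rfloor$, $\lfloor\Delta|X\to Y\rfloor$ infer $\lfloor\Gamma|\Delta|Y\rfloor$; permutation of components; from $\lfloor\Gamma|X|X\rfloor$ infer $\lfloor\Gamma|X\rfloor$; from $\lfloor\Gamma\rfloor$ infer $\lfloor\Gamma|X\rfloor$; from $\lfloor\Gamma|X\to Y\rfloor$ infer $\lfloor\Gamma|\neg X|[X]Y\rfloor$; from $\lfloor\Gamma|Y\leftrightarrow\neg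 X\rfloor$, $\lfloor\Gamma|[X]Z\leftrightarrow Z\rfloor$ infer $\lfloor\Gamma|[Y]Z\leftrightarrow Z\rfloor$. $\vdash$ means derivable. -}

module Defs where

open import Data.List using (List; []; _∷_; _++_; [_])
open import Data.List.Relation.Binary.Permutation.Propositional using (_↭_)

data Cond (Atom : Set) : Set where
  ⊥'   : Cond Atom
  atom : Atom → Cond Atom
  _⇒_  : Cond Atom → Cond Atom → Cond Atom
  ⟦_⟧_ : Cond Atom → Cond Atom → Cond Atom

infixr 5 _⇒_
infix 7 ⟦_⟧_

module _ {Atom : Set} where
  ¬' : Cond Atom → Cond Atom
  ¬' X = X ⇒ ⊥'

  _∨'_ : Cond Atom → Cond Atom → Cond Atom
  X ∨' Y = ¬' X ⇒ Y

  _∧'_ : Cond Atom → Cond Atom → Cond Atom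
  X ∧' Y = ¬' (¬' X ∨' ¬' Y)

  ⊤' : Cond Atom
  ⊤' = ¬' ⊥'

  _⇔_ : Cond Atom → Cond Atom → Cond Atom
  X ⇔ Y = (X ⇒ Y) ∧' (Y ⇒ X)

  -- A Bayesian proposition ⌊X₁|…|Xₙ⌋ is represented by the list X₁ ∷ … ∷ Xₙ ∷ [];
  -- derivable ones are always nonempty (n ≥ 1).  ⌊Γ|X⌋ is Γ ++ [ X ].
  data ⊢_ : List (Cond Atom) → Set where
    ax-K  : ∀ X Y → ⊢ [ X ⇒ (Y ⇒ X) ]
    ax-S  : ∀ X Y Z → ⊢ [ (X ⇒ (Y ⇒ Z)) ⇒ ((X ⇒ Y) ⇒ (X ⇒ Z)) ]
    ax-C  : ∀ X Y → ⊢ [ (¬' X ⇒ ¬' Y) ⇒ (Y ⇒ X) ]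
    ax-Kc : ∀ X Y Z → ⊢ [ (⟦ X ⟧ (Y ⇒ Z)) ⇒ ((⟦ X ⟧ Y) ⇒ (⟦ X ⟧ Z)) ]
    ax-MP : ∀ X Y → ⊢ [ (⟦ X ⟧ Y) ⇒ (X ⇒ Y) ]
    ax-N  : ∀ X Y → ⊢ [ (⟦ X ⟧ (¬' Y)) ⇔ ¬' (⟦ X ⟧ Y) ]
    mp    : ∀ Γ Δ X Y → ⊢ (Γ ++ [ X ]) → ⊢ (Δ ++ [ X ⇒ Y ]) → ⊢ (Γ ++ Δ ++ [ Y ])
    perm  : ∀ {Γ Δ} → Γ ↭ Δ → ⊢ Γ → ⊢ Δ
    contr : ∀ Γ X → ⊢ (Γ ++ X ∷ X ∷ []) → ⊢ (Γ ++ [ X ])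
    weak  : ∀ Γ X → ⊢ Γ → ⊢ (Γ ++ [ X ])
    cond  : ∀ Γ X Y → ⊢ (Γ ++ [ X ⇒ Y ]) → ⊢ (Γ ++ ¬' X ∷ [ ⟦ X ⟧ Y ])
    subst : ∀ Γ X Y Z → ⊢ (Γ ++ [ Y ⇔ ¬' X ]) → ⊢ (Γ ++ [ (⟦ X ⟧ Z) ⇔ Z ])
          → ⊢ (Γ ++ [ (⟦ Y ⟧ Z) ⇔ Z ])

-- The substitution rule lets us replace the antecedent of a trivial
-- conditional by any proposition provably equivalent to the negation of the
-- old antecedent.  Take the old antecedent to be ⊤: the conditional [⊤]Z is
-- provably equivalent to Z (one direction is the axiom [X]Z → (X → Z), the
-- other follows from [X]¬Z ↔ ¬[X]Z).  And from ¬X we get X ↔ ¬⊤.  So one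
-- application of the substitution rule, in context Γ, gives the theorem; the
-- special case X = ⊥ uses the closed theorem ¬⊥.
module Submission where

open import Defs
open import Data.List using (List; _++_; [_]; []; _∷_)
open import Data.List.Membership.Propositional using (_∈_)
open import Data.List.Relation.Unary.Any using (here; there)
open import Data.List.Properties using (++-identityʳ; ++-assoc)
open import Data.List.Relation.Binary.Permutation.Propositional.Properties using (++-comm)
open import Data.Product using (_×_; _,_)
open import Relation.Binary.PropositionalEquality using (refl; sym) renaming (subst to transport)

module _ {Atom : Set} where

  data _⊩_ (Hs : List (Cond Atom)) : Cond Atom → Set where
    hyp     : ∀ {A} → A ∈ Hs → Hs ⊩ A
    theorem : ∀ {A} → ⊢ [ A ] → Hs ⊩ A
    app     : ∀ {A B} → Hs ⊩ (A ⇒ B) → Hs ⊩ A → Hs ⊩ B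

  infix 4 _⊩_

  close : ∀ {A} → [] ⊩ A → ⊢ [ A ]
  close (hyp ())
  close (theorem p) = p
  close (app f a)   = mp [] [] _ _ (close a) (close f)

  identity : ∀ A → ⊢ [ A ⇒ A ]
  identity A = close (app (app (theorem (ax-S A (A ⇒ A) A))
                               (theorem (ax-K A (A ⇒ A))))
                          (theorem (ax-K A A)))

  lam : ∀ {Hs H B} → (H ∷ Hs) ⊩ B → Hs ⊩ (H ⇒ B)
  lam {H = H} (hyp (here refl)) = theorem (identity H)
  lam (hyp (there i))           = app (theorem (ax-K _ _)) (hyp i)
  lam (theorem p)               = app (theorem (ax-K _ _)) (theorem p)
  lam (app f a)                 = app (app (theorem (ax-S _ _ _)) (lam f)) (lam a)

  var₀ : ∀ {Hs A} → (A ∷ Hs) ⊩ A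
  var₀ = hyp (here refl)

  var₁ : ∀ {Hs A B} → (B ∷ A ∷ Hs) ⊩ A
  var₁ = hyp (there (here refl))

  weaken : ∀ {Hs H A} → Hs ⊩ A → (H ∷ Hs) ⊩ A
  weaken (hyp i)     = hyp (there i)
  weaken (theorem p) = theorem p
  weaken (app f a)   = app (weaken f) (weaken a)

  truth : ∀ {Hs} → Hs ⊩ ⊤'
  truth = theorem (identity ⊥')

  ex-falso : ∀ {Hs B} → Hs ⊩ ⊥' → Hs ⊩ B
  ex-falso {B = B} p = app (app (theorem (ax-C B ⊥')) (lam truth)) p

  double-negation : ∀ {Hs A} → Hs ⊩ ¬' (¬' A) → Hs ⊩ A
  double-negation {A = A} p =
    app (app (theorem (ax-C A ⊤')) (lam (ex-falso (app (weaken p) var₀)))) truth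

  ∧-intro : ∀ {Hs A B} → Hs ⊩ A → Hs ⊩ B → Hs ⊩ (A ∧' B)
  ∧-intro a b = lam (app (app var₀ (lam (app var₀ (weaken (weaken a))))) (weaken b))

  ∧-elimʳ : ∀ {Hs A B} → Hs ⊩ (A ∧' B) → Hs ⊩ B
  ∧-elimʳ c = double-negation (lam (app (weaken c) (lam var₁)))

  append : ∀ (Δ Γ : List (Cond Atom)) → ⊢ Δ → ⊢ (Δ ++ Γ)
  append Δ []      p = transport ⊢_ (sym (++-identityʳ Δ)) p
  append Δ (X ∷ Γ) p = transport ⊢_ (++-assoc Δ [ X ] Γ) (append (Δ ++ [ X ]) Γ (weak Δ X p))

  in-context : ∀ (Γ : List (Cond Atom)) {A} → ⊢ [ A ] → ⊢ (Γ ++ [ A ])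
  in-context Γ {A} p = perm (++-comm [ A ] Γ) (append [ A ] Γ p)

  -- A refuted proposition is equivalent to ¬⊤; this matches the first
  -- premise of the substitution rule with old antecedent ⊤.
  refuted⇒≡¬⊤ : ∀ X → ⊢ [ ¬' X ⇒ (X ⇔ ¬' ⊤') ]
  refuted⇒≡¬⊤ X = close (lam (∧-intro (lam (ex-falso (app var₁ var₀)))
                                      (lam (ex-falso (app var₀ truth)))))

  -- Conditioning on ⊤ is trivial: ⌊[⊤]Z ↔ Z⌋.  Left to right by [⊤]Z → (⊤ → Z);
  -- right to left by contradiction, turning ¬[⊤]Z into [⊤]¬Z and hence ¬Z.
  trivial-⊤ : ∀ Z → ⊢ [ (⟦ ⊤' ⟧ Z) ⇔ Z ]
  trivial-⊤ Z = close (∧-intro conditional⇒Z Z⇒conditional)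
    where
    conditional⇒Z : [] ⊩ (⟦ ⊤' ⟧ Z) ⇒ Z
    conditional⇒Z = lam (app (app (theorem (ax-MP ⊤' Z)) var₀) truth)

    ¬conditional⇒¬Z : ∀ {Hs} → Hs ⊩ ¬' (⟦ ⊤' ⟧ Z) → Hs ⊩ ¬' Z
    ¬conditional⇒¬Z n =
      app (app (theorem (ax-MP ⊤' (¬' Z))) (app (∧-elimʳ (theorem (ax-N ⊤' Z))) n)) truth

    Z⇒conditional : [] ⊩ Z ⇒ (⟦ ⊤' ⟧ Z)
    Z⇒conditional = lam (double-negation (lam (app (¬conditional⇒¬Z var₀) var₁)))

  refuted-antecedent : (X Y : Cond Atom) (Γ : List (Cond Atom))
    → ⊢ (Γ ++ [ ¬' X ]) → ⊢ (Γ ++ [ (⟦ X ⟧ Y) ⇔ Y ])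
  refuted-antecedent X Y Γ ⊢¬X =
    subst Γ ⊤' X Y (mp Γ [] _ _ ⊢¬X (refuted⇒≡¬⊤ X)) (in-context Γ (trivial-⊤ Y))

mainTheorem15 : {Atom : Set}
    → ((X Y : Cond Atom) (Γ : List (Cond Atom))
    → ⊢ (Γ ++ [ ¬' X ]) → ⊢ (Γ ++ [ (⟦ X ⟧ Y) ⇔ Y ]))
    × ((Y : Cond Atom) (Γ : List (Cond Atom))
    → ⊢ (Γ ++ [ (⟦ ⊥' ⟧ Y) ⇔ Y ]))
mainTheorem15 =
  refuted-antecedent ,
  λ Y Γ → refuted-antecedent ⊥' Y Γ (in-context Γ (identity ⊥'))   -- ¬⊥ is ⊥ → ⊥
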